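{- Let $p$ be a prime, $m$ a positive integer divisible by $3$, $n=\frac m3(p-1)$, $U=[0,n]^2$, and $0\le i\le n$. Let $J_{i+1},\dots,J_n$ be a backward consistent sequence of ideals of $U$, let $J_i$ be an ideal of $U$, and put $W_j=\omega_U(J_j)$ for $i\le j\le n$. Let $\alpha_i$ be the largest integer with $1\le\alpha_i\le p-1$, $i+\alpha_i\le n$ and $J_{i+\alpha_i}\ne\emptyset$ (if it exists). Let $X_i=W_{i+1}\vee\bigl[\underline{(W_{i+p}+(1,0))}_{[0,n+1]\times[0,n]}\big|_U\bigr]\vee\bigl[\underline{(W_{i+\alpha_i}+(1,-p^2+p\alpha_i))}_{[0,n+1]\times[-p^2+p\alpha_i,n]}\big|_U\bigr]$ and $Y_i=\overline{(W_{i+1})}_{[0,n]\times[-p,n]}\big|_{[0,n]\times[-p,-p+n]}+(0,p)$. Then $J_i$ is consistent with $J_{i+1},\dots,J_n$ if and only if $X_i\le W_i\le Y_i$.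
   Context: $D=\{(x,y)\in\mathbb{R}^2: x+py\le0,\ p^2x+y\le0\}$, $\Delta=\{(x,y,z)\in\mathbb{R}^3: x+py+p^2z\le0,\ p^2x+y+pz\le0,\ px+p^2y+z\le0\}$; $u\prec v$ means $u\in v+D$ in $\mathbb{R}^2$ and $u\in v+\Delta$ in $\mathbb{R}^3$. An ideal of $\Omega$ is $I\subseteq\Omega$ with $u\in I$, $v\in\Omega$, $v\prec u\Rightarrow v\in I$. $[a,b]=\{x\in\mathbb{Z}:a\le x\le b\}$. $J_{i+1},\dots,J_n$ is backward consistent if $\bigcup_{j=i+1}^n(J_j\times\{j\})$ is an ideal of $U\times[i+1,n]$; $J_i$ is consistent with it if $J_i,\dots,J_n$ is backward consistent. Walks: a rectangle is $R=[a,b]\times[c,d]$ ($a\le b$, $c\le d$ integers). A walk in $R$ is the empty sequence $\emptyset$ or a sequence $(x_0,y_0),\dots,(x_k,y_k)$ of points of $R$ with: (1) $x_0=a$ or $y_0=d$, and $x_k=b$ or $y_k=c$; (2) each step is horizontal, $(x_t,y_t)=(x_{t-1}+h,y_{t-1})$ with $1\le h\le p$, or vertical, $(x_t,y_t)=(x_{t-1},y_{t-1}-v)$ with $1\le v\le p^2$; (3) steps alternate; (4) if $a\le x_0<b$ and $y_0=d$ the first step is vertical, and if $x_k=b$, $c\le y_k<d$ the last step is horizontal; (5) a horizontal first step has length $\le p-1$ and a vertical last step has length $\le p^2-1$. $\iota_R(W)=\{(x,y)\in R: x\le x_t,\ y\le y_t\text{ for some }t\}$, $\iota_R(\emptyset)=\emptyset$;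 $\iota_R$ is a bijection from walks in $R$ to ideals of $R$, with inverse $\omega_R$. $W_1\le W_2$ iff $\iota_R(W_1)\subseteq\iota_R(W_2)$; $W_1\vee W_2=\omega_R(\iota_R(W_1)\cup\iota_R(W_2))$. For rectangles $R'\subseteq R$: $W|_{R'}=\omega_{R'}(\iota_R(W)\cap R')$; for $Z$ a walk in $R'$, $\overline{Z}_R=\omega_R(K)$ with $K$ the largest ideal of $R$ with $K\cap R'=\iota_{R'}(Z)$, and $\underline{Z}_R=\omega_R(L)$ with $L$ the smallest such ideal. $W+(h,v)$ is $W$ translated by $(h,v)$. Any walk in a $\vee$ expression that is undefined (e.g. the second term if $i+p>n$, the third if $\alpha_i$ does not exist) is ignored. -}

module Defs where

open import Data.Nat as ℕ using (ℕ; _∸_)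
open import Data.Integer as ℤ using (ℤ; +_; _+_; _-_; _*_; -_)
open import Data.Bool using (Bool; true; false)
open import Data.Product using (Σ; _×_; _,_; ∃)
open import Data.Sum using (_⊎_)
open import Relation.Binary.PropositionalEquality using (_≡_)
open import Function.Bundles using (_⇔_)

Point : Set
Point = ℤ × ℤ

-- A subset of ℤ² (all sets in the paper are finite subsets of rectangles,
-- so they are represented by Bool-valued characteristic functions).
Sub : Set
Sub = Point → Bool

_∈_ : Point → Sub → Set
u ∈ S = S u ≡ true

infix 4 _∈_

Rect : ℤ → ℤ → ℤ → ℤ → Point → Set
Rect a b c d (x , y) = (a ℤ.≤ x × x ℤ.≤ b) × (c ℤ.≤ y × y ℤ.≤ d)

U : ℕ → Point → Set
U n = Rect (+ 0) (+ n) (+ 0) (+ n)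

Prec2 : ℕ → Point → Point → Set
Prec2 p (x , y) (x' , y') =
  ((x - x') + (+ p) * (y - y') ℤ.≤ + 0) ×
  ((+ p) * (+ p) * (x - x') + (y - y') ℤ.≤ + 0)

Prec3 : ℕ → ℤ × ℤ × ℤ → ℤ × ℤ × ℤ → Set
Prec3 p (x , y , z) (x' , y' , z') =
  ((dx + P * dy) + P * P * dz ℤ.≤ + 0) ×
  ((P * P * dx + dy) + P * dz ℤ.≤ + 0) ×
  ((P * dx + P * P * dy) + dz ℤ.≤ + 0)
  where
  P = + p
  dx = x - x'
  dy = y - y'
  dz = z - z'

IsIdeal : ℕ → (Point → Set) → Sub → Set
IsIdeal p Ω I =
  (∀ u → u ∈ I → Ω u) ×
  (∀ u v → u ∈ I → Ω v → Prec2 p v u → v ∈ I)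

-- J_k, …, J_n is backward consistent:
-- ⋃_{j=k}^{n} (J_j × {j}) is an ideal of U × [k,n] (for the 3D order).
BackwardConsistent : ℕ → ℕ → ℕ → (ℕ → Sub) → Set
BackwardConsistent p n k J =
  (∀ j u → k ℕ.≤ j → j ℕ.≤ n → u ∈ J j → U n u) ×
  (∀ j u l v → k ℕ.≤ j → j ℕ.≤ n → u ∈ J j →
     U n v → k ℕ.≤ l → l ℕ.≤ n →
     Prec3 p (Data.Product.proj₁ v , Data.Product.proj₂ v , + l)
             (Data.Product.proj₁ u , Data.Product.proj₂ u , + j) →
     v ∈ J l)

-- Operations on ideals corresponding to the operations on walks
-- (via the bijection ι_R between walks in R and ideals of R).

RestrictsTo : (Point → Set) → Sub → Sub → Set
RestrictsTo R' K I = ∀ u → ((u ∈ K × R' u) ⇔ u ∈ I)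

-- L is the smallest ideal of R with L ∩ R' = I  (i.e. L = ι_R(underline Z_R)
-- where I = ι_{R'}(Z))
IsSmallestExt : ℕ → (Point → Set) → (Point → Set) → Sub → Sub → Set
IsSmallestExt p R R' I L =
  IsIdeal p R L × RestrictsTo R' L I ×
  (∀ L' → IsIdeal p R L' → RestrictsTo R' L' I → ∀ u → u ∈ L → u ∈ L')

IsLargestExt : ℕ → (Point → Set) → (Point → Set) → Sub → Sub → Set
IsLargestExt p R R' I K =
  IsIdeal p R K × RestrictsTo R' K I ×
  (∀ K' → IsIdeal p R K' → RestrictsTo R' K' I → ∀ u → u ∈ K' → u ∈ K)

-- translation: ι(W + (h,v)) = ι(W) + (h,v)
shift : ℤ → ℤ → Sub → Sub
shift h v S (x , y) = S (x - h , y - v)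

NonEmpty : Sub → Set
NonEmpty S = ∃ λ u → u ∈ S

AlphaCond : ℕ → ℕ → ℕ → (ℕ → Sub) → ℕ → Set
AlphaCond p n i J β =
  1 ℕ.≤ β × β ℕ.≤ p ∸ 1 × i ℕ.+ β ℕ.≤ n × NonEmpty (J (i ℕ.+ β))

IsAlpha : ℕ → ℕ → ℕ → (ℕ → Sub) → ℕ → Set
IsAlpha p n i J α =
  AlphaCond p n i J α × (∀ β → AlphaCond p n i J β → β ℕ.≤ α)

-- L2 : the smallest ideal of [0,n+1]×[0,n] extending ι(W_{i+p} + (1,0)),
-- L3 α : the smallest ideal of [0,n+1]×[-p²+pα, n] extending
--        ι(W_{i+α} + (1, -p²+pα)).
-- ι_U(X_i) = J_{i+1} ∪ (L2 ∩ U) ∪ (L3 α_i ∩ U), undefined terms ignored.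
Xset : ℕ → ℕ → ℕ → (ℕ → Sub) → Sub → (ℕ → Sub) → Point → Set
Xset p n i J L2 L3 u =
  (i ℕ.+ 1 ℕ.≤ n × u ∈ J (i ℕ.+ 1)) ⊎
  (i ℕ.+ p ℕ.≤ n × u ∈ L2 × U n u) ⊎
  (Σ ℕ λ α → IsAlpha p n i J α × u ∈ L3 α × U n u)

-- K : the largest ideal of [0,n]×[-p,n] with K ∩ U = J_{i+1};
-- ι_U(Y_i) = (K ∩ [0,n]×[-p,-p+n]) + (0,p).
Yset : ℕ → ℕ → Sub → Point → Set
Yset p n K (x , y) =
  Rect (+ 0) (+ n) (- (+ p)) (- (+ p) + + n) (x , y - + p) ×
  (x , y - + p) ∈ K

module Submission where

-- Consistency of J_i asks for two closure properties in the 3D order.  Upwards: if (v, l) ≺ (u, i)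
-- with u ∈ J_i and l > i then v ∈ J_l.  For a nonnegative level difference dz the cone Δ is the
-- planar cone D translated by (0, p dz), so such a relation factors through a point of J_{i+1}
-- lying below u - (0, p); this is exactly the condition W_i ≤ Y_i.  Downwards: if (v, i) ≺ (u, i + k)
-- with u ∈ J_{i+k}, a case analysis on k ≥ p or k < p and on the position of v shows that the
-- relation factors through (v, i + 1), through (v - (1, 0), i + p) or the corner (p - 1, v_y - 1) at
-- level i + p, or through (v - (1, pα - p²), i + α); these are the generators of the three terms of
-- X_i, so X_i ≤ W_i suffices.  Conversely, consistency gives X_i ≤ W_i since every generator of X_i
-- lies below a point of a later J_j, and W_i ≤ Y_i since everything in U below u - (0, p) lies below
-- (u, i) at level i + 1.

open import Defs
open import Data.Nat as ℕ using (ℕ; z≤n; s≤s; _∸_)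
import Data.Nat.Properties as ℕP
open import Data.Nat.Properties using (anyUpTo?; allUpTo?)
open import Data.Integer as ℤ using (ℤ; +_; -_; +≤+; 0ℤ; 1ℤ)
import Data.Integer.Properties as ℤP
open import Data.Integer.Tactic.RingSolver using (solve)
open import Data.List using (_∷_; [])
open import Data.Product using (Σ; ∃; _×_; _,_; proj₁; proj₂)
open import Data.Sum using (_⊎_; inj₁; inj₂)
open import Data.Empty using (⊥; ⊥-elim)
open import Relation.Nullary using (Dec; yes; no)
open import Relation.Nullary.Decidable using (map′; _×-dec_; _→-dec_; dec-true)
open import Relation.Unary using (Decidable)
open import Data.Bool using (true)
open import Data.Bool.Properties using () renaming (_≟_ to _≟ᵇ_)
open import Function.Bundles using (_⇔_; mk⇔; Equivalence)
open import Relation.Binary.PropositionalEquality using (_≡_; refl; sym; trans; cong; cong₂; subst; subst₂)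

module Arithmetic where
  open import Data.Integer using (_+_; _-_; _*_; _≤_)

  ≤0-≡ : ∀ {a} b → a ≡ b → b ≤ 0ℤ → a ≤ 0ℤ
  ≤0-≡ b refl h = h

  ≤-by-difference : ∀ {a b a' b'} → a - b ≡ a' - b' → a ≤ b → a' ≤ b'
  ≤-by-difference eq h = ℤP.i-j≤0⇒i≤j (subst (_≤ 0ℤ) eq (ℤP.i≤j⇒i-j≤0 h))

  *-≤0 : ∀ {c a} → 0ℤ ≤ c → a ≤ 0ℤ → c * a ≤ 0ℤ
  *-≤0 {+ c} {a} _ a≤0 = subst (+ c * a ≤_) (ℤP.*-zeroʳ (+ c)) (ℤP.*-monoˡ-≤-nonNeg (+ c) a≤0)

  0≤* : ∀ {a b} → 0ℤ ≤ a → 0ℤ ≤ b → 0ℤ ≤ a * b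
  0≤* {+ a} {+ b} _ _ = subst (0ℤ ≤_) (ℤP.pos-* a b) (+≤+ z≤n)

  ≤-or-> : ∀ a b → a ≤ b ⊎ b + 1ℤ ≤ a
  ≤-or-> a b with a ℤP.≤? b
  ... | yes a≤b = inj₁ a≤b
  ... | no a≰b = inj₂ (subst (_≤ a) (ℤP.+-comm 1ℤ b) (ℤP.i<j⇒suc[i]≤j (ℤP.≰⇒> a≰b)))

  i-j≤i : ∀ i {j} → 0ℤ ≤ j → i - j ≤ i
  i-j≤i i {+ m} _ = ℤP.i-j≤i i (+ m)

  positive≰0 : ∀ {k} → + ℕ.suc k ≤ 0ℤ → ⊥
  positive≰0 (+≤+ ())

  x-1∈[0,n] : ∀ {n x} → 1ℤ ≤ x → x ≤ + n → 0ℤ ≤ x - 1ℤ × x - 1ℤ ≤ + n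
  x-1∈[0,n] {n} {x} 1≤x x≤n = ℤP.i≤j⇒0≤j-i 1≤x , ℤP.≤-trans (i-j≤i x (+≤+ z≤n)) x≤n

  level-diff : ∀ i a b → + (i ℕ.+ a) - + (i ℕ.+ b) ≡ + a - + b
  level-diff i a b = trans (cong₂ _-_ (ℤP.pos-+ i a) (ℤP.pos-+ i b)) (eq (+ i) (+ a) (+ b))
    where
    eq : ∀ I A B → (I + A) - (I + B) ≡ A - B
    eq I A B = solve (I ∷ A ∷ B ∷ [])

  level-drop : ∀ i a → + i - + (i ℕ.+ a) ≡ - + a
  level-drop i a = trans (cong (λ t → + i - t) (ℤP.pos-+ i a)) (eq (+ i) (+ a))
    where
    eq : ∀ I A → I - (I + A) ≡ - A
    eq I A = solve (I ∷ A ∷ [])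

  level-rise : ∀ i a → + (i ℕ.+ a) - + i ≡ + a
  level-rise i a = trans (cong (_- + i) (ℤP.pos-+ i a)) (eq (+ i) (+ a))
    where
    eq : ∀ I A → (I + A) - I ≡ A
    eq I A = solve (I ∷ A ∷ [])

  shiftedRect⇔U : ∀ n c d → d ≡ + n + c → ∀ x y →
    Rect (+ 1) (+ (n ℕ.+ 1)) c d (x , y) ⇔ U n (x - 1ℤ , y - c)
  shiftedRect⇔U n c d refl x y = mk⇔
    (λ ((1≤x , x≤n+1) , (c≤y , y≤d)) →
       (ℤP.i≤j⇒0≤j-i 1≤x , ≤-by-difference (eqx (+ n)) (subst (x ≤_) (ℤP.pos-+ n 1) x≤n+1)) ,
       (ℤP.i≤j⇒0≤j-i c≤y , ≤-by-difference (eqy (+ n)) y≤d))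
    (λ ((0≤x-1 , x-1≤n) , (0≤y-c , y-c≤n)) →
       (≤-by-difference (eq₀ x 1ℤ) 0≤x-1 , subst (x ≤_) (sym (ℤP.pos-+ n 1)) (≤-by-difference (sym (eqx (+ n))) x-1≤n)) ,
       (≤-by-difference (eq₀ y c) 0≤y-c , ≤-by-difference (sym (eqy (+ n))) y-c≤n))
    where
    eqx : ∀ N → x - (N + 1ℤ) ≡ (x - 1ℤ) - N
    eqx N = solve (x ∷ N ∷ [])
    eqy : ∀ N → y - (N + c) ≡ (y - c) - N
    eqy N = solve (y ∷ c ∷ N ∷ [])
    eq₀ : ∀ a b → 0ℤ - (a - b) ≡ b - a
    eq₀ a b = solve (a ∷ b ∷ [])

module Cone (P : ℤ) (2≤P : + 2 ℤ.≤ P) where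
  open import Data.Integer using (_+_; _-_; _*_; _≤_)
  open Arithmetic

  -- With P = + p, InD (vx - ux) (vy - uy) unfolds to Prec2 p v u and
  -- InΔ (vx - ux) (vy - uy) (+ l - + j) to Prec3 p (vx , vy , + l) (ux , uy , + j).
  InD : ℤ → ℤ → Set
  InD a b = (a + P * b ≤ 0ℤ) × (P * P * a + b ≤ 0ℤ)

  InΔ : ℤ → ℤ → ℤ → Set
  InΔ dx dy dz =
    ((dx + P * dy) + P * P * dz ≤ 0ℤ) ×
    ((P * P * dx + dy) + P * dz ≤ 0ℤ) ×
    ((P * dx + P * P * dy) + dz ≤ 0ℤ)

  0≤P : 0ℤ ≤ P
  0≤P = ℤP.≤-trans (+≤+ z≤n) 2≤P

  0≤P-1 : 0ℤ ≤ P - 1ℤ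
  0≤P-1 = ℤP.i≤j⇒0≤j-i (ℤP.≤-trans (+≤+ (s≤s z≤n)) 2≤P)

  0≤P*P : 0ℤ ≤ P * P
  0≤P*P = 0≤* 0≤P 0≤P

  0≤P³-1 : 0ℤ ≤ P * P * P - 1ℤ
  0≤P³-1 = subst (0ℤ ≤_) eq (0≤* 0≤P-1 (ℤP.+-mono-≤ (ℤP.+-mono-≤ 0≤P*P 0≤P) (+≤+ {0} {1} z≤n)))
    where
    eq : (P - 1ℤ) * ((P * P + P) + 1ℤ) ≡ P * P * P - 1ℤ
    eq = solve (P ∷ [])

  P²-1≰0 : P * P - 1ℤ ≤ 0ℤ → ⊥
  P²-1≰0 h = positive≰0 (≤0-≡ _ eq (ℤP.+-mono-≤ h (*-≤0 (ℤP.+-mono-≤ 0≤P (+≤+ {0} {2} z≤n)) (ℤP.neg-mono-≤ (ℤP.i≤j⇒0≤j-i 2≤P)))))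
    where
    eq : + 3 ≡ (P * P - 1ℤ) + (P + + 2) * (- (P - + 2))
    eq = solve (P ∷ [])

  P*-≤0⇒≤0 : ∀ a → P * a ≤ 0ℤ → a ≤ 0ℤ
  P*-≤0⇒≤0 a h with ≤-or-> a 0ℤ
  ... | inj₁ a≤0 = a≤0
  ... | inj₂ 1≤a = ⊥-elim (positive≰0 (≤0-≡ _ eq (ℤP.+-mono-≤ (ℤP.+-mono-≤ (ℤP.i≤j⇒i-j≤0 2≤P) (*-≤0 0≤P (ℤP.i≤j⇒i-j≤0 1≤a))) h)))
    where
    eq : + 2 ≡ ((+ 2 - P) + P * ((0ℤ + 1ℤ) - a)) + P * a
    eq = solve (P ∷ a ∷ [])

  InD-0 : InD 0ℤ 0ℤ
  InD-0 = ≤0-≡ 0ℤ eq₁ ℤP.≤-refl , ≤0-≡ 0ℤ eq₂ ℤP.≤-refl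
    where
    eq₁ : 0ℤ + P * 0ℤ ≡ 0ℤ
    eq₁ = solve (P ∷ [])
    eq₂ : P * P * 0ℤ + 0ℤ ≡ 0ℤ
    eq₂ = solve (P ∷ [])

  InD-+ : ∀ {a b a' b'} → InD a b → InD a' b' → InD (a + a') (b + b')
  InD-+ {a} {b} {a'} {b'} (h₁ , h₂) (h₁' , h₂') = ≤0-≡ _ eq₁ (ℤP.+-mono-≤ h₁ h₁') , ≤0-≡ _ eq₂ (ℤP.+-mono-≤ h₂ h₂')
    where
    eq₁ : (a + a') + P * (b + b') ≡ (a + P * b) + (a' + P * b')
    eq₁ = solve (a ∷ b ∷ a' ∷ b' ∷ P ∷ [])
    eq₂ : P * P * (a + a') + (b + b') ≡ (P * P * a + b) + (P * P * a' + b')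
    eq₂ = solve (a ∷ b ∷ a' ∷ b' ∷ P ∷ [])

  InD-intro : ∀ a b → a + P * b ≤ 0ℤ → 0ℤ ≤ b → InD a b
  InD-intro a b h 0≤b = h , ≤0-≡ _ eq (ℤP.+-mono-≤ (*-≤0 0≤P*P h) (*-≤0 0≤P³-1 (ℤP.neg-mono-≤ 0≤b)))
    where
    eq : P * P * a + b ≡ P * P * (a + P * b) + (P * P * P - 1ℤ) * (- b)
    eq = solve (a ∷ b ∷ P ∷ [])

  InD-ray : ∀ s → 0ℤ ≤ s → InD (- (P * s)) s
  InD-ray s 0≤s = InD-intro _ _ (≤0-≡ 0ℤ eq ℤP.≤-refl) 0≤s
    where
    eq : - (P * s) + P * s ≡ 0ℤ
    eq = solve (s ∷ P ∷ [])

  InΔ⇒InD : ∀ dx dy dz → InΔ dx dy dz → InD dx (dy + P * dz)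
  InΔ⇒InD dx dy dz (h₁ , h₂ , _) = ≤0-≡ _ eq₁ h₁ , ≤0-≡ _ eq₂ h₂
    where
    eq₁ : dx + P * (dy + P * dz) ≡ (dx + P * dy) + P * P * dz
    eq₁ = solve (dx ∷ dy ∷ dz ∷ P ∷ [])
    eq₂ : P * P * dx + (dy + P * dz) ≡ (P * P * dx + dy) + P * dz
    eq₂ = solve (dx ∷ dy ∷ dz ∷ P ∷ [])

  InD⇒InΔ : ∀ dx dy dz → 0ℤ ≤ dz → InD dx (dy + P * dz) → InΔ dx dy dz
  InD⇒InΔ dx dy dz 0≤dz (h₁ , h₂) =
    ≤0-≡ _ eq₁ h₁ , ≤0-≡ _ eq₂ h₂ , ≤0-≡ _ eq₃ (ℤP.+-mono-≤ (*-≤0 0≤P h₁) (*-≤0 0≤P³-1 (ℤP.neg-mono-≤ 0≤dz)))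
    where
    eq₁ : (dx + P * dy) + P * P * dz ≡ dx + P * (dy + P * dz)
    eq₁ = solve (dx ∷ dy ∷ dz ∷ P ∷ [])
    eq₂ : (P * P * dx + dy) + P * dz ≡ P * P * dx + (dy + P * dz)
    eq₂ = solve (dx ∷ dy ∷ dz ∷ P ∷ [])
    eq₃ : (P * dx + P * P * dy) + dz ≡ P * (dx + P * (dy + P * dz)) + (P * P * P - 1ℤ) * (- dz)
    eq₃ = solve (dx ∷ dy ∷ dz ∷ P ∷ [])

  InΔ-intro : ∀ dx dy dz → dz ≤ 0ℤ →
    (P * P * dx + dy) + P * dz ≤ 0ℤ → (P * dx + P * P * dy) + dz ≤ 0ℤ → InΔ dx dy dz
  InΔ-intro dx dy dz dz≤0 h₂ h₃ = P*-≤0⇒≤0 _ (≤0-≡ _ eq (ℤP.+-mono-≤ h₃ (*-≤0 0≤P³-1 dz≤0))) , h₂ , h₃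
    where
    eq : P * ((dx + P * dy) + P * P * dz) ≡ ((P * dx + P * P * dy) + dz) + (P * P * P - 1ℤ) * dz
    eq = solve (dx ∷ dy ∷ dz ∷ P ∷ [])

  InΔ-nonPos : ∀ dx dy dz → dx ≤ 0ℤ → dy ≤ 0ℤ → dz ≤ 0ℤ → InΔ dx dy dz
  InΔ-nonPos dx dy dz dx≤0 dy≤0 dz≤0 = InΔ-intro dx dy dz dz≤0
    (ℤP.+-mono-≤ (ℤP.+-mono-≤ (*-≤0 0≤P*P dx≤0) dy≤0) (*-≤0 0≤P dz≤0))
    (ℤP.+-mono-≤ (ℤP.+-mono-≤ (*-≤0 0≤P dx≤0) (*-≤0 0≤P*P dy≤0)) dz≤0)

  -P²+PA≤0 : ∀ A → A ≤ P → - (P * P) + P * A ≤ 0ℤ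
  -P²+PA≤0 A A≤P = ≤0-≡ _ eq (*-≤0 0≤P (ℤP.i≤j⇒i-j≤0 A≤P))
    where
    eq : - (P * P) + P * A ≡ P * (A - P)
    eq = solve (A ∷ P ∷ [])

  -- A step (1, P T - P²) in the plane is paid for by T levels: this produces the last two terms of X_i.
  InΔ-translate : ∀ ux uy wx wy c T → c ≡ - (P * P) + P * T → 0ℤ ≤ T → T ≤ P →
    InD (ux - (wx + 1ℤ)) (uy - (wy + c)) → InΔ (ux - wx) (uy - wy) (- T)
  InΔ-translate ux uy wx wy c T refl 0≤T T≤P (h₁ , h₂) =
    InΔ-intro _ _ _ (ℤP.neg-mono-≤ 0≤T) (≤0-≡ _ eq₂ h₂) (≤0-≡ _ eq₃ (ℤP.+-mono-≤ (*-≤0 0≤P h₁) (*-≤0 0≤P³-1 (ℤP.i≤j⇒i-j≤0 T≤P))))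
    where
    eq₂ : (P * P * (ux - wx) + (uy - wy)) + P * (- T) ≡ P * P * (ux - (wx + 1ℤ)) + (uy - (wy + (- (P * P) + P * T)))
    eq₂ = solve (ux ∷ uy ∷ wx ∷ wy ∷ T ∷ P ∷ [])
    eq₃ : (P * (ux - wx) + P * P * (uy - wy)) + (- T) ≡ P * ((ux - (wx + 1ℤ)) + P * (uy - (wy + (- (P * P) + P * T)))) + (P * P * P - 1ℤ) * (T - P)
    eq₃ = solve (ux ∷ uy ∷ wx ∷ wy ∷ T ∷ P ∷ [])

  module _ (n : ℕ) (K ux uy vx vy : ℤ) where

    -- The ways in which (v, i) ≺ (u, i + K) factors through a generator of X_i:
    -- next through W_{i+1}, left and corner through W_{i+p} + (1,0), slant through W_{i+α} + (1, pα - p²).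
    data Descent : Set where
      next   : InΔ (vx - ux) (vy - uy) (1ℤ - K) → Descent
      left   : P ≤ K → U n (vx - 1ℤ , vy) → InΔ ((vx - 1ℤ) - ux) (vy - uy) (P - K) → Descent
      corner : P ≤ K → vx ≡ 0ℤ → 1ℤ ≤ vy →
               InΔ ((P - 1ℤ) - ux) ((vy - 1ℤ) - uy) (P - K) → Descent
      slant  : K + 1ℤ ≤ P →
               (∀ A c → c ≡ - (P * P) + P * A → K ≤ A → A ≤ P →
                  U n (vx - 1ℤ , vy - c) × InΔ ((vx - 1ℤ) - ux) ((vy - c) - uy) (A - K)) →
               Descent

  descent-slant : ∀ n K ux uy vx vy → U n (ux , uy) → U n (vx , vy) → 1ℤ ≤ vx - ux →
    (P * P * (vx - ux) + (vy - uy)) + P * (- K) ≤ 0ℤ →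
    ∀ A c → c ≡ - (P * P) + P * A → K ≤ A → A ≤ P →
    U n (vx - 1ℤ , vy - c) × InΔ ((vx - 1ℤ) - ux) ((vy - c) - uy) (A - K)
  descent-slant n K ux uy vx vy ((0≤ux , _) , (_ , uy≤n)) ((_ , vx≤n) , (0≤vy , _)) 1≤dx H₂ A c refl K≤A A≤P =
    (x-1∈[0,n] 1≤vx vx≤n , (0≤vy-c , vy-c≤n)) ,
    InD⇒InΔ _ _ _ (ℤP.i≤j⇒0≤j-i K≤A)
      ( ≤0-≡ _ eq₃ (ℤP.+-mono-≤ (*-≤0 0≤P³-1 (ℤP.i≤j⇒i-j≤0 1≤dx)) (*-≤0 0≤P H₂))
      , ≤0-≡ _ eq₄ H₂)
    where
    1≤vx : 1ℤ ≤ vx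
    1≤vx = ℤP.≤-trans 1≤dx (i-j≤i vx 0≤ux)
    eq₁ : c - vy ≡ P * (A - P) + (- vy)
    eq₁ = solve (vy ∷ A ∷ P ∷ [])
    0≤vy-c : 0ℤ ≤ vy - c
    0≤vy-c = ℤP.i≤j⇒0≤j-i {c} (ℤP.i-j≤0⇒i≤j (≤0-≡ _ eq₁ (ℤP.+-mono-≤ (*-≤0 0≤P (ℤP.i≤j⇒i-j≤0 A≤P)) (ℤP.neg-mono-≤ 0≤vy))))
    eq₂ : ∀ N → (vy - c) - N ≡ (((P * P * (vx - ux) + (vy - uy)) + P * (- K)) + (uy - N)) + P * (K - A) + P * P * (1ℤ - (vx - ux))
    eq₂ N = solve (vx ∷ vy ∷ ux ∷ uy ∷ N ∷ K ∷ A ∷ P ∷ [])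
    vy-c≤n : vy - c ≤ + n
    vy-c≤n = ℤP.i-j≤0⇒i≤j (≤0-≡ _ (eq₂ (+ n)) (ℤP.+-mono-≤ (ℤP.+-mono-≤ (ℤP.+-mono-≤ H₂ (ℤP.i≤j⇒i-j≤0 uy≤n)) (*-≤0 0≤P (ℤP.i≤j⇒i-j≤0 K≤A))) (*-≤0 0≤P*P (ℤP.i≤j⇒i-j≤0 1≤dx))))
    eq₃ : ((vx - 1ℤ) - ux) + P * (((vy - c) - uy) + P * (A - K)) ≡ (P * P * P - 1ℤ) * (1ℤ - (vx - ux)) + P * ((P * P * (vx - ux) + (vy - uy)) + P * (- K))
    eq₃ = solve (vx ∷ vy ∷ ux ∷ uy ∷ K ∷ A ∷ P ∷ [])
    eq₄ : P * P * ((vx - 1ℤ) - ux) + (((vy - c) - uy) + P * (A - K)) ≡ (P * P * (vx - ux) + (vy - uy)) + P * (- K)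
    eq₄ = solve (vx ∷ vy ∷ ux ∷ uy ∷ K ∷ A ∷ P ∷ [])

  descent-deep : ∀ n K ux uy vx vy → U n (ux , uy) → U n (vx , vy) → 1ℤ ≤ K → P ≤ K →
    InΔ (vx - ux) (vy - uy) (- K) → Descent n K ux uy vx vy
  descent-deep n K ux uy vx vy ((0≤ux , _) , (0≤uy , _)) ((0≤vx , vx≤n) , vy∈[0,n]) 1≤K P≤K (_ , H₂ , H₃)
    with ≤-or-> vx 0ℤ
  ... | inj₂ 1≤vx = left P≤K (x-1∈[0,n] 1≤vx vx≤n , vy∈[0,n])
                      (InΔ-intro _ _ _ (ℤP.i≤j⇒i-j≤0 P≤K) (≤0-≡ _ eq₂ H₂) (≤0-≡ _ eq₃ H₃))
    where
    eq₂ : (P * P * ((vx - 1ℤ) - ux) + (vy - uy)) + P * (P - K) ≡ (P * P * (vx - ux) + (vy - uy)) + P * (- K)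
    eq₂ = solve (vx ∷ vy ∷ ux ∷ uy ∷ K ∷ P ∷ [])
    eq₃ : (P * ((vx - 1ℤ) - ux) + P * P * (vy - uy)) + (P - K) ≡ (P * (vx - ux) + P * P * (vy - uy)) + (- K)
    eq₃ = solve (vx ∷ vy ∷ ux ∷ uy ∷ K ∷ P ∷ [])
  ... | inj₁ vx≤0 with ≤-or-> (vy - uy) 0ℤ
  ...   | inj₁ dy≤0 = next (InΔ-nonPos _ _ _ (ℤP.+-mono-≤ vx≤0 (ℤP.neg-mono-≤ 0≤ux)) dy≤0 (ℤP.i≤j⇒i-j≤0 1≤K))
  ...   | inj₂ 1≤dy = corner P≤K (ℤP.≤-antisym vx≤0 0≤vx) 1≤vy
          (InΔ-intro _ _ _ (ℤP.i≤j⇒i-j≤0 P≤K)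
            (≤0-≡ _ eq₂ (ℤP.+-mono-≤ (ℤP.+-mono-≤ (*-≤0 0≤P H₃) (*-≤0 0≤P³-1 (ℤP.i≤j⇒i-j≤0 1≤dy))) (*-≤0 0≤P*P (ℤP.neg-mono-≤ 0≤vx))))
            (≤0-≡ _ eq₃ (ℤP.+-mono-≤ H₃ (*-≤0 0≤P (ℤP.neg-mono-≤ 0≤vx)))))
    where
    eq₁ : 1ℤ - vy ≡ ((0ℤ + 1ℤ) - (vy - uy)) + (- uy)
    eq₁ = solve (vy ∷ uy ∷ [])
    1≤vy : 1ℤ ≤ vy
    1≤vy = ℤP.i-j≤0⇒i≤j (≤0-≡ _ eq₁ (ℤP.+-mono-≤ (ℤP.i≤j⇒i-j≤0 1≤dy) (ℤP.neg-mono-≤ 0≤uy)))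
    eq₂ : (P * P * ((P - 1ℤ) - ux) + ((vy - 1ℤ) - uy)) + P * (P - K) ≡ (P * ((P * (vx - ux) + P * P * (vy - uy)) + (- K)) + (P * P * P - 1ℤ) * ((0ℤ + 1ℤ) - (vy - uy))) + P * P * (- vx)
    eq₂ = solve (vx ∷ vy ∷ ux ∷ uy ∷ K ∷ P ∷ [])
    eq₃ : (P * ((P - 1ℤ) - ux) + P * P * ((vy - 1ℤ) - uy)) + (P - K) ≡ ((P * (vx - ux) + P * P * (vy - uy)) + (- K)) + P * (- vx)
    eq₃ = solve (vx ∷ vy ∷ ux ∷ uy ∷ K ∷ P ∷ [])

  descent-shallow : ∀ n K ux uy vx vy → U n (ux , uy) → U n (vx , vy) → 1ℤ ≤ K → K + 1ℤ ≤ P →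
    InΔ (vx - ux) (vy - uy) (- K) → Descent n K ux uy vx vy
  descent-shallow n K ux uy vx vy uU vU 1≤K K<P (_ , H₂ , H₃)
    with ≤-or-> ((P * P * (vx - ux) + (vy - uy)) + P * (1ℤ - K)) 0ℤ
  ... | inj₁ t₂ = next (InΔ-intro _ _ _ (ℤP.i≤j⇒i-j≤0 1≤K) t₂ t₃)
    where
    -- H₃ says P (dx + P dy) ≤ K < P, hence dx + P dy ≤ 0.
    f≤0 : (vx - ux) + P * (vy - uy) ≤ 0ℤ
    f≤0 with ≤-or-> ((vx - ux) + P * (vy - uy)) 0ℤ
    ... | inj₁ f≤0 = f≤0
    ... | inj₂ 1≤f = ⊥-elim (positive≰0 (≤0-≡ _ eq (ℤP.+-mono-≤ (ℤP.+-mono-≤ (*-≤0 0≤P (ℤP.i≤j⇒i-j≤0 1≤f)) (ℤP.i≤j⇒i-j≤0 K<P)) H₃)))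
      where
      eq : + 1 ≡ (P * ((0ℤ + 1ℤ) - ((vx - ux) + P * (vy - uy))) + ((K + 1ℤ) - P)) + ((P * (vx - ux) + P * P * (vy - uy)) + (- K))
      eq = solve (vx ∷ vy ∷ ux ∷ uy ∷ K ∷ P ∷ [])
    eq₃ : (P * (vx - ux) + P * P * (vy - uy)) + (1ℤ - K) ≡ P * ((vx - ux) + P * (vy - uy)) + (1ℤ - K)
    eq₃ = solve (vx ∷ vy ∷ ux ∷ uy ∷ K ∷ P ∷ [])
    t₃ : (P * (vx - ux) + P * P * (vy - uy)) + (1ℤ - K) ≤ 0ℤ
    t₃ = ≤0-≡ _ eq₃ (ℤP.+-mono-≤ (*-≤0 0≤P f≤0) (ℤP.i≤j⇒i-j≤0 1≤K))
  ... | inj₂ ¬t₂ = slant K<P (descent-slant n K ux uy vx vy uU vU 1≤dx H₂)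
    where
    1≤dx : 1ℤ ≤ vx - ux
    1≤dx with ≤-or-> (vx - ux) 0ℤ
    ... | inj₂ 1≤dx = 1≤dx
    ... | inj₁ dx≤0 = ⊥-elim (P²-1≰0 (≤0-≡ _ eq
          (ℤP.+-mono-≤ (ℤP.+-mono-≤ (ℤP.+-mono-≤ H₃ (*-≤0 0≤P*P (ℤP.i≤j⇒i-j≤0 ¬t₂))) (*-≤0 (0≤* 0≤P 0≤P³-1) dx≤0)) (*-≤0 0≤P³-1 (ℤP.i≤j⇒i-j≤0 1≤K)))))
      where
      eq : P * P - 1ℤ ≡ (((P * (vx - ux) + P * P * (vy - uy)) + (- K)) + P * P * ((0ℤ + 1ℤ) - ((P * P * (vx - ux) + (vy - uy)) + P * (1ℤ - K)))) + P * (P * P * P - 1ℤ) * (vx - ux) + (P * P * P - 1ℤ) * (1ℤ - K)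
      eq = solve (vx ∷ vy ∷ ux ∷ uy ∷ K ∷ P ∷ [])

  descent : ∀ n K ux uy vx vy → U n (ux , uy) → U n (vx , vy) → 1ℤ ≤ K →
    InΔ (vx - ux) (vy - uy) (- K) → Descent n K ux uy vx vy
  descent n K ux uy vx vy uU vU 1≤K with ≤-or-> P K
  ... | inj₁ P≤K = descent-deep n K ux uy vx vy uU vU 1≤K P≤K
  ... | inj₂ K<P = descent-shallow n K ux uy vx vy uU vU 1≤K K<P

  AscentPoint : ℕ → ℤ → ℤ → ℤ → ℤ → ℤ → Set
  AscentPoint n D ux uy vx vy =
    Σ Point λ z → U n z × InD (proj₁ z - ux) (proj₂ z - (uy - P)) × InD (vx - proj₁ z) ((vy - proj₂ z) + P * D)

  ascent-inside : ∀ n D ux uy vx vy → 0ℤ ≤ D → U n (vx , vy) → vy + P * D ≤ + n →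
    InD (vx - ux) ((vy - uy) + P * (D + 1ℤ)) → AscentPoint n D ux uy vx vy
  ascent-inside n D ux uy vx vy 0≤D ((0≤vx , vx≤n) , (0≤vy , _)) top≤n H =
    (vx , vy + P * D) , ((0≤vx , vx≤n) , (ℤP.+-mono-≤ 0≤vy (0≤* 0≤P 0≤D) , top≤n)) ,
    subst (InD (vx - ux)) eq₁ H , subst₂ InD eq₂ eq₃ InD-0
    where
    eq₁ : (vy - uy) + P * (D + 1ℤ) ≡ (vy + P * D) - (uy - P)
    eq₁ = solve (vy ∷ uy ∷ D ∷ P ∷ [])
    eq₂ : 0ℤ ≡ vx - vx
    eq₂ = solve (vx ∷ [])
    eq₃ : 0ℤ ≡ (vy - (vy + P * D)) + P * D
    eq₃ = solve (vy ∷ D ∷ P ∷ [])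

  -- v is moved along the ray (-P, 1) of D until it reaches the top edge y = n.
  ascent-top-edge : ∀ n D ux uy vx vy → U n (ux , uy) → U n (vx , vy) → + n + 1ℤ ≤ vy + P * D →
    InD (vx - ux) ((vy - uy) + P * (D + 1ℤ)) → AscentPoint n D ux uy vx vy
  ascent-top-edge n D ux uy vx vy ((_ , ux≤n) , (_ , uy≤n)) ((0≤vx , _) , (0≤vy , vy≤n)) n<top H =
    (zx , + n) , ((ℤP.+-mono-≤ 0≤vx (0≤* 0≤P 0≤s) , zx≤n) , (ℤP.≤-trans 0≤vy vy≤n , ℤP.≤-refl)) ,
    InD-intro _ _ H' 0≤dy , subst₂ InD (eq₄ s) (eq₅ (+ n)) (InD-ray s 0≤s)
    where
    s zx : ℤ
    s = (vy + P * D) - + n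
    zx = vx + P * s
    0≤s : 0ℤ ≤ s
    0≤s = ℤP.i≤j⇒0≤j-i (ℤP.≤-trans (ℤP.i≤i+j (+ n) 1ℤ) n<top)
    dy : ℤ
    dy = + n - (uy - P)
    eq₀ : ∀ N → (N - uy) + P ≡ N - (uy - P)
    eq₀ N = solve (N ∷ uy ∷ P ∷ [])
    0≤dy : 0ℤ ≤ dy
    0≤dy = subst (0ℤ ≤_) (eq₀ (+ n)) (ℤP.+-mono-≤ (ℤP.i≤j⇒0≤j-i uy≤n) 0≤P)
    eqH : ∀ N → (vx + P * ((vy + P * D) - N)) - ux + P * (N - (uy - P)) ≡ (vx - ux) + P * ((vy - uy) + P * (D + 1ℤ))
    eqH N = solve (vx ∷ vy ∷ ux ∷ uy ∷ N ∷ D ∷ P ∷ [])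
    H' : (zx - ux) + P * dy ≤ 0ℤ
    H' = ≤0-≡ _ (eqH (+ n)) (proj₁ H)
    eqz : ∀ N → (vx + P * ((vy + P * D) - N)) - N ≡ ((vx + P * ((vy + P * D) - N)) - ux + P * (N - (uy - P))) + P * (- (N - (uy - P))) + (ux - N)
    eqz N = solve (vx ∷ vy ∷ ux ∷ uy ∷ N ∷ D ∷ P ∷ [])
    zx≤n : zx ≤ + n
    zx≤n = ℤP.i-j≤0⇒i≤j (≤0-≡ _ (eqz (+ n)) (ℤP.+-mono-≤ (ℤP.+-mono-≤ H' (*-≤0 0≤P (ℤP.neg-mono-≤ 0≤dy))) (ℤP.i≤j⇒i-j≤0 ux≤n)))
    eq₄ : ∀ S → - (P * S) ≡ vx - (vx + P * S)
    eq₄ S = solve (vx ∷ S ∷ P ∷ [])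
    eq₅ : ∀ N → (vy + P * D) - N ≡ (vy - N) + P * D
    eq₅ N = solve (vy ∷ N ∷ D ∷ P ∷ [])

  ascent : ∀ n D ux uy vx vy → 0ℤ ≤ D → U n (ux , uy) → U n (vx , vy) →
    InD (vx - ux) ((vy - uy) + P * (D + 1ℤ)) → AscentPoint n D ux uy vx vy
  ascent n D ux uy vx vy 0≤D uU vU with ≤-or-> (vy + P * D) (+ n)
  ... | inj₁ top≤n = ascent-inside n D ux uy vx vy 0≤D vU top≤n
  ... | inj₂ n<top = ascent-top-edge n D ux uy vx vy uU vU n<top

module _ (n : ℕ) {Q : Point → Set} (Q? : Decidable Q) where

  ∃-U? : Dec (∃ λ w → U n w × Q w)
  ∃-U? = map′ to from (anyUpTo? (λ x → anyUpTo? (λ y → Q? (+ x , + y)) (ℕ.suc n)) (ℕ.suc n))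
    where
    to : (∃ λ x → x ℕ.< ℕ.suc n × ∃ λ y → y ℕ.< ℕ.suc n × Q (+ x , + y)) → ∃ λ w → U n w × Q w
    to (x , s≤s x≤n , y , s≤s y≤n , q) = (+ x , + y) , ((+≤+ z≤n , +≤+ x≤n) , (+≤+ z≤n , +≤+ y≤n)) , q
    from : (∃ λ w → U n w × Q w) → ∃ λ x → x ℕ.< ℕ.suc n × ∃ λ y → y ℕ.< ℕ.suc n × Q (+ x , + y)
    from ((+ x , + y) , ((_ , +≤+ x≤n) , (_ , +≤+ y≤n)) , q) = x , s≤s x≤n , y , s≤s y≤n , q
    from ((ℤ.-[1+ _ ] , _) , ((() , _) , _) , _)
    from ((+ _ , ℤ.-[1+ _ ]) , (_ , (() , _)) , _)

  ∀-U? : Dec (∀ w → U n w → Q w)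
  ∀-U? = map′ to from (allUpTo? (λ x → allUpTo? (λ y → Q? (+ x , + y)) (ℕ.suc n)) (ℕ.suc n))
    where
    to : (∀ {x} → x ℕ.< ℕ.suc n → ∀ {y} → y ℕ.< ℕ.suc n → Q (+ x , + y)) → ∀ w → U n w → Q w
    to h (+ x , + y) ((_ , +≤+ x≤n) , (_ , +≤+ y≤n)) = h (s≤s x≤n) (s≤s y≤n)
    to h (ℤ.-[1+ _ ] , _) ((() , _) , _)
    to h (+ _ , ℤ.-[1+ _ ]) (_ , (() , _))
    from : (∀ w → U n w → Q w) → ∀ {x} → x ℕ.< ℕ.suc n → ∀ {y} → y ℕ.< ℕ.suc n → Q (+ x , + y)
    from h {x} (s≤s x≤n) {y} (s≤s y≤n) = h (+ x , + y) ((+≤+ z≤n , +≤+ x≤n) , (+≤+ z≤n , +≤+ y≤n))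

module _ {Q : Point → Set} (Q? : Decidable Q) where

  toSub : Sub
  toSub z = Dec.does (Q? z)

  ∈-toSub⁺ : ∀ {z} → Q z → z ∈ toSub
  ∈-toSub⁺ {z} = dec-true (Q? z)

  ∈-toSub⁻ : ∀ {z} → z ∈ toSub → Q z
  ∈-toSub⁻ {z} = does⇒ (Q? z)
    where
    does⇒ : ∀ {A : Set} (a? : Dec A) → Dec.does a? ≡ true → A
    does⇒ (yes a) _ = a
    does⇒ (no _) ()

∈? : (S : Sub) → Decidable (_∈ S)
∈? S u = S u ≟ᵇ true

Prec2? : ∀ p → (u : Point) → Decidable (λ v → Prec2 p v u)
Prec2? p (x' , y') (x , y) = (_ ℤP.≤? _) ×-dec (_ ℤP.≤? _)

Rect? : ∀ a b c d → Decidable (Rect a b c d)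
Rect? a b c d (x , y) = ((_ ℤP.≤? _) ×-dec (_ ℤP.≤? _)) ×-dec ((_ ℤP.≤? _) ×-dec (_ ℤP.≤? _))

module Extensions (p : ℕ) (2≤p : 2 ℕ.≤ p) where
  open import Data.Integer using (_+_; _-_; _*_; _≤_)
  open Arithmetic
  open Cone (+ p) (+≤+ 2≤p)

  Prec2-refl : ∀ v → Prec2 p v v
  Prec2-refl (x , y) = subst₂ InD (eq x) (eq y) InD-0
    where
    eq : ∀ x → 0ℤ ≡ x - x
    eq x = solve (x ∷ [])

  Prec2-trans : ∀ v w u → Prec2 p v w → Prec2 p w u → Prec2 p v u
  Prec2-trans (vx , vy) (wx , wy) (ux , uy) h₁ h₂ = subst₂ InD (eq vx wx ux) (eq vy wy uy) (InD-+ h₁ h₂)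
    where
    eq : ∀ a b c → (a - b) + (b - c) ≡ a - c
    eq a b c = solve (a ∷ b ∷ c ∷ [])

  module _ (n : ℕ) {I : Sub} (I-ideal : IsIdeal p (U n) I) (h c : ℤ)
           {R R' : Point → Set} (R? : Decidable R)
           (R'⇔ : ∀ x y → R' (x , y) ⇔ U n (x - h , y - c)) (R'⊆R : ∀ z → R' z → R z) where

    -- The down-set of the translate is an ideal of R with the right trace on R', so minimality applies.
    BelowShift : Point → Set
    BelowShift z = R z × ∃ λ w → w ∈ I × Prec2 p z (proj₁ w + h , proj₂ w + c)

    belowShift? : Decidable BelowShift
    belowShift? z = R? z ×-dec map′ to from (∃-U? n (λ w → ∈? I w ×-dec Prec2? p (proj₁ w + h , proj₂ w + c) z))
      where
      to : (∃ λ w → U n w × w ∈ I × Prec2 p z (proj₁ w + h , proj₂ w + c)) → ∃ λ w → w ∈ I × Prec2 p z (proj₁ w + h , proj₂ w + c)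
      to (w , _ , q) = w , q
      from : (∃ λ w → w ∈ I × Prec2 p z (proj₁ w + h , proj₂ w + c)) → ∃ λ w → U n w × w ∈ I × Prec2 p z (proj₁ w + h , proj₂ w + c)
      from (w , w∈I , q) = w , proj₁ I-ideal w w∈I , w∈I , q

    belowShift-ideal : IsIdeal p R (toSub belowShift?)
    belowShift-ideal = (λ z z∈ → proj₁ (∈-toSub⁻ belowShift? z∈)) , down
      where
      down : ∀ z z' → z ∈ toSub belowShift? → R z' → Prec2 p z' z → z' ∈ toSub belowShift?
      down z z' z∈ Rz' z'≺z with ∈-toSub⁻ belowShift? z∈
      ... | _ , w , w∈I , z≺w = ∈-toSub⁺ belowShift? (Rz' , w , w∈I , Prec2-trans z' z _ z'≺z z≺w)

    belowShift-restricts : RestrictsTo R' (toSub belowShift?) (shift h c I)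
    belowShift-restricts (x , y) = mk⇔ to from
      where
      eq : ∀ a b d → a - (b + d) ≡ (a - d) - b
      eq a b d = solve (a ∷ b ∷ d ∷ [])
      to : (x , y) ∈ toSub belowShift? × R' (x , y) → shift h c I (x , y) ≡ true
      to (z∈ , R'z) with ∈-toSub⁻ belowShift? z∈
      ... | _ , (wx , wy) , w∈I , z≺w = proj₂ I-ideal (wx , wy) (x - h , y - c) w∈I (Equivalence.to (R'⇔ x y) R'z)
                                          (subst₂ InD (eq x wx h) (eq y wy c) z≺w)
      eq' : ∀ a d → 0ℤ ≡ a - ((a - d) + d)
      eq' a d = solve (a ∷ d ∷ [])
      from : shift h c I (x , y) ≡ true → (x , y) ∈ toSub belowShift? × R' (x , y)
      from z∈ = ∈-toSub⁺ belowShift? (R'⊆R _ R'z , (x - h , y - c) , z∈ , subst₂ InD (eq' x h) (eq' y c) InD-0) , R'z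
        where
        R'z : R' (x , y)
        R'z = Equivalence.from (R'⇔ x y) (proj₁ I-ideal _ z∈)

    smallestExt⊆belowShift : ∀ {L} → IsSmallestExt p R R' (shift h c I) L →
      ∀ z → z ∈ L → ∃ λ w → w ∈ I × Prec2 p z (proj₁ w + h , proj₂ w + c)
    smallestExt⊆belowShift (_ , _ , minimal) z z∈L =
      proj₂ (∈-toSub⁻ belowShift? (minimal _ belowShift-ideal belowShift-restricts z z∈L))

  module _ (n : ℕ) {I : Sub} (I-ideal : IsIdeal p (U n) I)
           {R : Point → Set} (R? : Decidable R) (U⊆R : ∀ z → U n z → R z) where

    AboveU : Point → Set
    AboveU z = R z × (∀ w → U n w → Prec2 p w z → w ∈ I)

    aboveU? : Decidable AboveU
    aboveU? z = R? z ×-dec ∀-U? n (λ w → Prec2? p z w →-dec ∈? I w)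

    aboveU-ideal : IsIdeal p R (toSub aboveU?)
    aboveU-ideal = (λ z z∈ → proj₁ (∈-toSub⁻ aboveU? z∈)) , down
      where
      down : ∀ z z' → z ∈ toSub aboveU? → R z' → Prec2 p z' z → z' ∈ toSub aboveU?
      down z z' z∈ Rz' z'≺z = ∈-toSub⁺ aboveU? (Rz' , λ w wU w≺z' → proj₂ (∈-toSub⁻ aboveU? z∈) w wU (Prec2-trans w z' z w≺z' z'≺z))

    aboveU-restricts : RestrictsTo (U n) (toSub aboveU?) I
    aboveU-restricts z = mk⇔
      (λ (z∈ , zU) → proj₂ (∈-toSub⁻ aboveU? z∈) z zU (Prec2-refl z))
      (λ z∈I → ∈-toSub⁺ aboveU? (U⊆R z (proj₁ I-ideal z z∈I) , λ w wU w≺z → proj₂ I-ideal z w z∈I wU w≺z) , proj₁ I-ideal z z∈I)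

    aboveU⊆largestExt : ∀ {K} → IsLargestExt p R (U n) I K → ∀ z → AboveU z → z ∈ K
    aboveU⊆largestExt (_ , _ , maximal) z z∈ = maximal _ aboveU-ideal aboveU-restricts z (∈-toSub⁺ aboveU? z∈)

largest : {Q : ℕ → Set} → Decidable Q → ∀ N → (∀ b → Q b → b ℕ.≤ N) →
          ∀ {k} → Q k → ∃ λ a → Q a × (∀ b → Q b → b ℕ.≤ a)
largest Q? N bound qk with Q? N
... | yes qN = N , qN , bound
largest {Q} Q? ℕ.zero bound {k} qk | no ¬qN = ⊥-elim (¬qN (subst Q (ℕP.n≤0⇒n≡0 (bound k qk)) qk))
largest {Q} Q? (ℕ.suc N) bound qk | no ¬qN = largest Q? N bound' qk
  where
  bound' : ∀ b → Q b → b ℕ.≤ N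
  bound' b qb = ℕP.m<1+n⇒m≤n (ℕP.≤∧≢⇒< (bound b qb) (λ { refl → ¬qN qb }))

data Level≥ (i : ℕ) : ℕ → Set where
  same   : Level≥ i i
  higher : ∀ k → 1 ℕ.≤ k → Level≥ i (i ℕ.+ k)

level≥ : ∀ {i j} → i ℕ.≤ j → Level≥ i j
level≥ {i} i≤j with ℕP.m≤n⇒∃[o]m+o≡n i≤j
... | ℕ.zero , refl = subst (Level≥ i) (sym (ℕP.+-identityʳ i)) same
... | ℕ.suc k , refl = higher (ℕ.suc k) (s≤s z≤n)

module Consistency
  (p n i : ℕ) (2≤p : 2 ℕ.≤ p) (i≤n : i ℕ.≤ n) (J : ℕ → Sub)
  (J-ideal : ∀ j → i ℕ.≤ j → j ℕ.≤ n → IsIdeal p (U n) (J j))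
  (L2 : Sub)
  (L2-spec : i ℕ.+ p ℕ.≤ n →
    IsSmallestExt p (Rect (+ 0) (+ (n ℕ.+ 1)) (+ 0) (+ n)) (Rect (+ 1) (+ (n ℕ.+ 1)) (+ 0) (+ n))
      (shift (+ 1) (+ 0) (J (i ℕ.+ p))) L2)
  (L3 : ℕ → Sub)
  (L3-spec : ∀ α → IsAlpha p n i J α →
    IsSmallestExt p
      (Rect (+ 0) (+ (n ℕ.+ 1)) (- (+ (p ℕ.* p)) ℤ.+ + (p ℕ.* α)) (+ n))
      (Rect (+ 1) (+ (n ℕ.+ 1)) (- (+ (p ℕ.* p)) ℤ.+ + (p ℕ.* α)) (+ n ℤ.+ (- (+ (p ℕ.* p)) ℤ.+ + (p ℕ.* α))))
      (shift (+ 1) (- (+ (p ℕ.* p)) ℤ.+ + (p ℕ.* α)) (J (i ℕ.+ α))) (L3 α))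
  (K : Sub)
  (K-spec : i ℕ.+ 1 ℕ.≤ n → IsLargestExt p (Rect (+ 0) (+ n) (- (+ p)) (+ n)) (U n) (J (i ℕ.+ 1)) K)
  where

  open import Data.Integer using (_+_; _-_; _*_; _≤_)
  open Arithmetic
  open Cone (+ p) (+≤+ 2≤p)
  open Extensions p 2≤p

  P : ℤ
  P = + p

  c[_] : ℕ → ℤ
  c[ α ] = - (+ (p ℕ.* p)) + + (p ℕ.* α)

  c[α]≡ : ∀ α → c[ α ] ≡ - (P * P) + P * + α
  c[α]≡ α = cong₂ (λ a b → - a + b) (ℤP.pos-* p p) (ℤP.pos-* p α)

  c[p]≡0 : 0ℤ ≡ - (P * P) + P * P
  c[p]≡0 = eq P
    where
    eq : ∀ Q → 0ℤ ≡ - (Q * Q) + Q * Q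
    eq Q = solve (Q ∷ [])

  U⊆lowered : ∀ z → U n z → Rect (+ 0) (+ n) (- P) (+ n) z
  U⊆lowered z (x∈ , (0≤y , y≤n)) = x∈ , (ℤP.≤-trans (ℤP.neg-mono-≤ 0≤P) 0≤y , y≤n)

  _at_≺_at_ : Point → ℕ → Point → ℕ → Set
  v at l ≺ u at j = Prec3 p (proj₁ v , proj₂ v , + l) (proj₁ u , proj₂ u , + j)

  DownClosedFrom : ℕ → Set
  DownClosedFrom k = ∀ j u l v → k ℕ.≤ j → j ℕ.≤ n → u ∈ J j → U n v → k ℕ.≤ l → l ℕ.≤ n → v at l ≺ u at j → v ∈ J l

  alphaCond? : Decidable (AlphaCond p n i J)
  alphaCond? β with i ℕ.+ β ℕ.≤? n
  ... | no i+β≰n = no (λ (_ , _ , i+β≤n , _) → i+β≰n i+β≤n)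
  ... | yes i+β≤n = map′ (λ (1≤β , β≤ , ne) → 1≤β , β≤ , i+β≤n , ne) (λ (1≤β , β≤ , _ , ne) → 1≤β , β≤ , ne)
                      (1 ℕ.≤? β ×-dec β ℕ.≤? p ∸ 1 ×-dec nonEmpty?)
    where
    nonEmpty? : Dec (NonEmpty (J (i ℕ.+ β)))
    nonEmpty? = map′ (λ (w , _ , w∈) → w , w∈) (λ (w , w∈) → w , proj₁ (J-ideal _ (ℕP.m≤m+n i β) i+β≤n) w w∈ , w∈)
                  (∃-U? n (∈? (J (i ℕ.+ β))))

  alpha-exists : ∀ {k} → AlphaCond p n i J k → ∃ (IsAlpha p n i J)
  alpha-exists condk =
    let (α , condα , maximal) = largest alphaCond? (p ∸ 1) (λ _ (_ , β≤ , _) → β≤) condk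
    in α , condα , maximal

  module Forward (BC : BackwardConsistent p n i J) where

    down-closed : DownClosedFrom i
    down-closed = proj₂ BC

    J[i+1]⊆J[i] : i ℕ.+ 1 ℕ.≤ n → ∀ u → u ∈ J (i ℕ.+ 1) → u ∈ J i
    J[i+1]⊆J[i] i+1≤n u u∈ =
      down-closed (i ℕ.+ 1) u i u (ℕP.m≤m+n i 1) i+1≤n u∈ (proj₁ (J-ideal _ (ℕP.m≤m+n i 1) i+1≤n) u u∈) ℕP.≤-refl i≤n
        (InΔ-nonPos _ _ _ (x-x≤0 (proj₁ u)) (x-x≤0 (proj₂ u)) (ℤP.i≤j⇒i-j≤0 (+≤+ (ℕP.m≤m+n i 1))))
      where
      x-x≤0 : ∀ x → x - x ≤ 0ℤ
      x-x≤0 x = ℤP.≤-reflexive (ℤP.+-inverseʳ x)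

    smallestExt⊆J[i] : ∀ T c d → c ≡ - (P * P) + P * + T → d ≡ + n + c → T ℕ.≤ p → i ℕ.+ T ℕ.≤ n → ∀ {L} →
      IsSmallestExt p (Rect (+ 0) (+ (n ℕ.+ 1)) c (+ n)) (Rect (+ 1) (+ (n ℕ.+ 1)) c d) (shift (+ 1) c (J (i ℕ.+ T))) L →
      ∀ u → u ∈ L → U n u → u ∈ J i
    smallestExt⊆J[i] T c d c≡ d≡ T≤p i+T≤n L-spec (ux , uy) u∈ uU =
      let ((wx , wy) , w∈ , u≺w) = smallestExt⊆belowShift n (J-ideal _ (ℕP.m≤m+n i T) i+T≤n) (+ 1) c (Rect? _ _ _ _)
                                     (shiftedRect⇔U n c d d≡) R'⊆R L-spec (ux , uy) u∈
      in down-closed (i ℕ.+ T) (wx , wy) i (ux , uy) (ℕP.m≤m+n i T) i+T≤n w∈ uU ℕP.≤-refl i≤n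
           (subst (InΔ (ux - wx) (uy - wy)) (sym (level-drop i T))
             (InΔ-translate ux uy wx wy c (+ T) c≡ (+≤+ z≤n) (+≤+ T≤p) u≺w))
      where
      eq : ∀ N C → C - 0ℤ ≡ (N + C) - N
      eq N C = solve (N ∷ C ∷ [])
      d≤n : d ≤ + n
      d≤n = subst (_≤ + n) (sym d≡) (≤-by-difference (eq (+ n) c) (subst (_≤ 0ℤ) (sym c≡) (-P²+PA≤0 (+ T) (+≤+ T≤p))))
      R'⊆R : ∀ z → Rect (+ 1) (+ (n ℕ.+ 1)) c d z → Rect (+ 0) (+ (n ℕ.+ 1)) c (+ n) z
      R'⊆R _ ((1≤x , x≤) , (c≤y , y≤d)) = (ℤP.≤-trans (+≤+ z≤n) 1≤x , x≤) , (c≤y , ℤP.≤-trans y≤d d≤n)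

    L2⊆J[i] : i ℕ.+ p ℕ.≤ n → ∀ u → u ∈ L2 → U n u → u ∈ J i
    L2⊆J[i] i+p≤n = smallestExt⊆J[i] p (+ 0) (+ n) c[p]≡0 (sym (ℤP.+-identityʳ (+ n))) ℕP.≤-refl i+p≤n (L2-spec i+p≤n)

    L3⊆J[i] : ∀ α → IsAlpha p n i J α → ∀ u → u ∈ L3 α → U n u → u ∈ J i
    L3⊆J[i] α isα@((_ , α≤p-1 , i+α≤n , _) , _) =
      smallestExt⊆J[i] α c[ α ] _ (c[α]≡ α) refl (ℕP.≤-trans α≤p-1 (ℕP.m∸n≤m p 1)) i+α≤n (L3-spec α isα)

    X⊆J[i] : ∀ u → Xset p n i J L2 L3 u → u ∈ J i
    X⊆J[i] u (inj₁ (i+1≤n , u∈)) = J[i+1]⊆J[i] i+1≤n u u∈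
    X⊆J[i] u (inj₂ (inj₁ (i+p≤n , u∈ , uU))) = L2⊆J[i] i+p≤n u u∈ uU
    X⊆J[i] u (inj₂ (inj₂ (α , isα , u∈ , uU))) = L3⊆J[i] α isα u u∈ uU

    J[i]⊆Y : i ℕ.+ 1 ℕ.≤ n → ∀ u → u ∈ J i → Yset p n K u
    J[i]⊆Y i+1≤n (ux , uy) u∈ =
      (x∈ , (-P≤uy-P , ≤-by-difference (eq₂ (+ n) P) uy≤n)) ,
      aboveU⊆largestExt n (J-ideal _ (ℕP.m≤m+n i 1) i+1≤n) (Rect? _ _ _ _) U⊆lowered (K-spec i+1≤n)
        (ux , uy - P) ((x∈ , (-P≤uy-P , ℤP.≤-trans (i-j≤i uy 0≤P) uy≤n)) , above)
      where
      uU : U n (ux , uy)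
      uU = proj₁ (J-ideal i ℕP.≤-refl i≤n) _ u∈
      x∈ : 0ℤ ≤ ux × ux ≤ + n
      x∈ = proj₁ uU
      uy≤n : uy ≤ + n
      uy≤n = proj₂ (proj₂ uU)
      eq₁ : ∀ Q → - Q - (uy - Q) ≡ 0ℤ - uy
      eq₁ Q = solve (uy ∷ Q ∷ [])
      -P≤uy-P : - P ≤ uy - P
      -P≤uy-P = ≤-by-difference (sym (eq₁ P)) (proj₁ (proj₂ uU))
      eq₂ : ∀ N Q → uy - N ≡ (uy - Q) - (- Q + N)
      eq₂ N Q = solve (uy ∷ Q ∷ N ∷ [])
      eq₃ : ∀ wy Q → wy - (uy - Q) ≡ (wy - uy) + Q * 1ℤ
      eq₃ wy Q = solve (wy ∷ uy ∷ Q ∷ [])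
      above : ∀ w → U n w → Prec2 p w (ux , uy - P) → w ∈ J (i ℕ.+ 1)
      above (wx , wy) wU w≺ =
        down-closed i (ux , uy) (i ℕ.+ 1) (wx , wy) ℕP.≤-refl i≤n u∈ wU (ℕP.m≤m+n i 1) i+1≤n
          (subst (InΔ (wx - ux) (wy - uy)) (sym (level-rise i 1))
            (InD⇒InΔ _ _ _ (+≤+ z≤n) (subst (InD (wx - ux)) (eq₃ wy P) w≺)))

  module Backward (BC₁ : BackwardConsistent p n (i ℕ.+ 1) J)
                  (X⊆J[i] : ∀ u → Xset p n i J L2 L3 u → u ∈ J i)
                  (J[i]⊆Y : i ℕ.+ 1 ℕ.≤ n → ∀ u → u ∈ J i → Yset p n K u) where

    down-closed₁ : DownClosedFrom (i ℕ.+ 1)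
    down-closed₁ = proj₂ BC₁

    level-split : ∀ l → + l - + i ≡ (+ l - + (i ℕ.+ 1)) + 1ℤ
    level-split l = trans (eq (+ l) (+ i)) (cong (λ t → (+ l - t) + 1ℤ) (sym (ℤP.pos-+ i 1)))
      where
      eq : ∀ L I → L - I ≡ (L - (I + 1ℤ)) + 1ℤ
      eq L I = solve (L ∷ I ∷ [])

    same-level : ∀ u v → u ∈ J i → U n v → v at i ≺ u at i → v ∈ J i
    same-level u v u∈ vU v≺u =
      proj₂ (J-ideal i ℕP.≤-refl i≤n) u v u∈ vU (subst (InD _) (eq _ P (+ i)) (InΔ⇒InD _ _ _ v≺u))
      where
      eq : ∀ dy Q I → dy + Q * (I - I) ≡ dy
      eq dy Q I = solve (dy ∷ Q ∷ I ∷ [])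

    -- By Y_i the point u - (0, p) lies in K, hence so does the intermediate point from ascent,
    -- which is therefore in J_{i+1}.
    ascend : ∀ u l v → u ∈ J i → U n v → i ℕ.+ 1 ℕ.≤ l → l ℕ.≤ n →
      v at l ≺ u at i → v ∈ J l
    ascend (ux , uy) l (vx , vy) u∈ vU i+1≤l l≤n v≺u =
      let (z , zU , z≺u' , v≺z) = ascent n (+ l - + (i ℕ.+ 1)) ux uy vx vy 0≤D uU vU
                                    (subst (InD (vx - ux)) (cong (λ t → (vy - uy) + P * t) (level-split l)) (InΔ⇒InD _ _ _ v≺u))
          z∈K = proj₂ (proj₁ (K-spec i+1≤n)) (ux , uy - P) z u'∈K (U⊆lowered z zU) z≺u'
          z∈J = Equivalence.to (proj₁ (proj₂ (K-spec i+1≤n)) z) (z∈K , zU)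
      in down-closed₁ (i ℕ.+ 1) z l (vx , vy) ℕP.≤-refl i+1≤n z∈J vU i+1≤l l≤n (InD⇒InΔ _ _ _ 0≤D v≺z)
      where
      i+1≤n : i ℕ.+ 1 ℕ.≤ n
      i+1≤n = ℕP.≤-trans i+1≤l l≤n
      uU : U n (ux , uy)
      uU = proj₁ (J-ideal i ℕP.≤-refl i≤n) _ u∈
      0≤D : 0ℤ ≤ + l - + (i ℕ.+ 1)
      0≤D = ℤP.i≤j⇒0≤j-i (+≤+ i+1≤l)
      u'∈K : (ux , uy - P) ∈ K
      u'∈K = proj₂ (J[i]⊆Y i+1≤n (ux , uy) u∈)

    left⇒L2 : i ℕ.+ p ℕ.≤ n → ∀ x y → (x - 1ℤ , y) ∈ J (i ℕ.+ p) → (x , y) ∈ L2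
    left⇒L2 i+p≤n x y w∈ = proj₁ (Equivalence.from (proj₁ (proj₂ (L2-spec i+p≤n)) (x , y))
                                   (subst (λ t → J (i ℕ.+ p) (x - 1ℤ , t) ≡ true) (sym (ℤP.+-identityʳ y)) w∈))

    corner⇒L2 : i ℕ.+ p ℕ.≤ n → ∀ y → U n (0ℤ , y) → (P - 1ℤ , y - 1ℤ) ∈ J (i ℕ.+ p) → (0ℤ , y) ∈ L2
    corner⇒L2 i+p≤n y vU w∈ = proj₂ (proj₁ (L2-spec i+p≤n)) _ _ (left⇒L2 i+p≤n P (y - 1ℤ) w∈)
                                ((+≤+ z≤n , +≤+ z≤n) , proj₂ vU) (subst₂ InD (eq₁ P) eq₂ (InD-ray 1ℤ (+≤+ z≤n)))
      where
      eq₁ : ∀ Q → - (Q * 1ℤ) ≡ 0ℤ - Q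
      eq₁ Q = solve (Q ∷ [])
      eq₂ : 1ℤ ≡ y - (y - 1ℤ)
      eq₂ = solve (y ∷ [])

    descend : ∀ k u v → 1 ℕ.≤ k → i ℕ.+ k ℕ.≤ n → u ∈ J (i ℕ.+ k) → U n v →
      v at i ≺ u at (i ℕ.+ k) → v ∈ J i
    descend k (ux , uy) (vx , vy) 1≤k i+k≤n u∈ vU v≺u =
      via (descent n (+ k) ux uy vx vy uU vU (+≤+ 1≤k) (subst (InΔ (vx - ux) (vy - uy)) (level-drop i k) v≺u))
      where
      uU : U n (ux , uy)
      uU = proj₁ (J-ideal _ (ℕP.m≤m+n i k) i+k≤n) _ u∈
      lower : ∀ a w → 1 ℕ.≤ a → i ℕ.+ a ℕ.≤ n → U n w → InΔ (proj₁ w - ux) (proj₂ w - uy) (+ a - + k) → w ∈ J (i ℕ.+ a)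
      lower a w 1≤a i+a≤n wU h = down-closed₁ (i ℕ.+ k) (ux , uy) (i ℕ.+ a) w (ℕP.+-monoʳ-≤ i 1≤k) i+k≤n u∈ wU
                                   (ℕP.+-monoʳ-≤ i 1≤a) i+a≤n (subst (InΔ _ _) (sym (level-diff i a k)) h)
      i+p≤n : P ≤ + k → i ℕ.+ p ℕ.≤ n
      i+p≤n P≤K = ℕP.≤-trans (ℕP.+-monoʳ-≤ i (ℤP.drop‿+≤+ P≤K)) i+k≤n
      1≤p : 1 ℕ.≤ p
      1≤p = ℕP.≤-trans (s≤s z≤n) 2≤p
      via : Descent n (+ k) ux uy vx vy → (vx , vy) ∈ J i
      via (next h) = X⊆J[i] _ (inj₁ (i+1≤n , lower 1 _ ℕP.≤-refl i+1≤n vU h))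
        where
        i+1≤n : i ℕ.+ 1 ℕ.≤ n
        i+1≤n = ℕP.≤-trans (ℕP.+-monoʳ-≤ i 1≤k) i+k≤n
      via (left P≤K wU h) = X⊆J[i] _ (inj₂ (inj₁ (i+p≤n P≤K , left⇒L2 (i+p≤n P≤K) vx vy (lower p _ 1≤p (i+p≤n P≤K) wU h) , vU)))
      via (corner P≤K refl 1≤vy h) =
        X⊆J[i] _ (inj₂ (inj₁ (i+p≤n P≤K , corner⇒L2 (i+p≤n P≤K) vy vU (lower p _ 1≤p (i+p≤n P≤K) wU h) , vU)))
        where
        P≤n : P ≤ + n
        P≤n = +≤+ (ℕP.≤-trans (ℕP.m≤n+m p i) (i+p≤n P≤K))
        wU : U n (P - 1ℤ , vy - 1ℤ)
        wU = x-1∈[0,n] (ℤP.≤-trans (+≤+ (s≤s z≤n)) (+≤+ 2≤p)) P≤n , x-1∈[0,n] 1≤vy (proj₂ (proj₂ vU))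
      via (slant K<P bounds) =
        let (α , isα@((1≤α , α≤p-1 , i+α≤n , _) , maximal)) = alpha-exists condk
            (wU , h) = bounds (+ α) c[ α ] (c[α]≡ α) (+≤+ (maximal k condk)) (+≤+ (ℕP.≤-trans α≤p-1 (ℕP.m∸n≤m p 1)))
            v∈L3 = proj₁ (Equivalence.from (proj₁ (proj₂ (L3-spec α isα)) (vx , vy)) (lower α _ 1≤α i+α≤n wU h))
        in X⊆J[i] _ (inj₂ (inj₂ (α , isα , v∈L3 , vU)))
        where
        condk : AlphaCond p n i J k
        condk = 1≤k , ℕP.m+n≤o⇒m≤o∸n k (ℤP.drop‿+≤+ K<P) , i+k≤n , ((ux , uy) , u∈)

    consistent : BackwardConsistent p n i J
    consistent = (λ j u i≤j j≤n u∈ → proj₁ (J-ideal j i≤j j≤n) u u∈) , down-closed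
      where
      down-closed : DownClosedFrom i
      down-closed j u l v i≤j j≤n u∈ vU i≤l l≤n v≺u with level≥ i≤j | level≥ i≤l
      ... | same | same = same-level u v u∈ vU v≺u
      ... | same | higher m 1≤m = ascend u (i ℕ.+ m) v u∈ vU (ℕP.+-monoʳ-≤ i 1≤m) l≤n v≺u
      ... | higher k 1≤k | same = descend k u v 1≤k j≤n u∈ vU v≺u
      ... | higher k 1≤k | higher m 1≤m =
        down-closed₁ (i ℕ.+ k) u (i ℕ.+ m) v (ℕP.+-monoʳ-≤ i 1≤k) j≤n u∈ vU (ℕP.+-monoʳ-≤ i 1≤m) l≤n v≺u

open import Data.Nat using (ℕ; _+_; _*_; _∸_; _≤_; _<_)
open import Data.Nat.DivMod using (_/_)
open import Data.Nat.Divisibility using (_∣_)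
open import Data.Nat.Primality using (Prime; prime⇒nonTrivial)
open import Data.Integer as ℤ using (+_; -_)
open import Data.Product using (_×_)
open import Function.Bundles using (_⇔_)
open import Relation.Binary.PropositionalEquality using (_≡_)

corollary4p7 :
    (p : ℕ) → Prime p →
    (m : ℕ) → 0 < m → 3 ∣ m →
    (n : ℕ) → n ≡ (m / 3) * (p ∸ 1) →
    (i : ℕ) → i ≤ n →
    (J : ℕ → Sub) →
    (∀ j → i ≤ j → j ≤ n → IsIdeal p (U n) (J j)) →
    BackwardConsistent p n (i + 1) J →
    (L2 : Sub) →
    (i + p ≤ n →
      IsSmallestExt p (Rect (+ 0) (+ (n + 1)) (+ 0) (+ n))
        (Rect (+ 1) (+ (n + 1)) (+ 0) (+ n))
        (shift (+ 1) (+ 0) (J (i + p))) L2) →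
    (L3 : ℕ → Sub) →
    (∀ α → IsAlpha p n i J α →
      IsSmallestExt p
        (Rect (+ 0) (+ (n + 1)) (- (+ (p * p)) ℤ.+ + (p * α)) (+ n))
        (Rect (+ 1) (+ (n + 1)) (- (+ (p * p)) ℤ.+ + (p * α))
              (+ n ℤ.+ (- (+ (p * p)) ℤ.+ + (p * α))))
        (shift (+ 1) (- (+ (p * p)) ℤ.+ + (p * α)) (J (i + α))) (L3 α)) →
    (K : Sub) →
    (i + 1 ≤ n →
      IsLargestExt p (Rect (+ 0) (+ n) (- (+ p)) (+ n)) (U n) (J (i + 1)) K) →
    (BackwardConsistent p n i J ⇔
      ((∀ u → Xset p n i J L2 L3 u → u ∈ J i) ×
       (i + 1 ≤ n → ∀ u → u ∈ J i → Yset p n K u)))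
corollary4p7 p p-prime _ _ _ n _ i i≤n J J-ideal BC₁ L2 L2-spec L3 L3-spec K K-spec =
  mk⇔ (λ BC → Forward.X⊆J[i] BC , Forward.J[i]⊆Y BC)
      (λ (X⊆J , J⊆Y) → Backward.consistent BC₁ X⊆J J⊆Y)
  where
  2≤p : 2 ≤ p
  2≤p = ℕ.nonTrivial⇒n>1 p {{prime⇒nonTrivial p-prime}}
  open Consistency p n i 2≤p i≤n J J-ideal L2 L2-spec L3 L3-spec K K-spec
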